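{- If $G$ is a connected $P_3$-$o_{ -1}$-heavy graph, then $G$ is traceable (i.e., $G$ contains a path passing through all its vertices).
   Context: All graphs are finite and simple; $d(v)$ is the degree of $v$ in $G$. $P_3$ is the path on 3 vertices. For a graph $H$, a graph $G$ on $n$ vertices is called $H$-$o_{ -1}$-heavy if every induced subgraph of $G$ isomorphic to $H$ contains two nonadjacent vertices whose degree sum in $G$ is at least $n-1$. -}

module Defs where

open import Data.Nat using (ℕ; zero; suc; _+_; _∸_; _≥_)
open import Data.Fin using (Fin)
open import Data.Bool using (Bool; true; false; if_then_else_; T)
open import Data.List using (List; []; _∷_; map; head; last)
open import Data.Nat.ListAction using (sum)
open import Data.List.Base using (allFin)
open import Data.List.Membership.Propositional using (_∈_)
open import Data.List.Relation.Unary.Unique.Propositional using (Unique)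
open import Data.Maybe using (just)
open import Data.Product using (Σ; _×_; ∃; ∃-syntax)
open import Relation.Binary.PropositionalEquality using (_≡_; _≢_)
open import Relation.Nullary using (¬_)

record Graph (n : ℕ) : Set where
  field
    adj   : Fin n → Fin n → Bool
    sym   : ∀ u v → adj u v ≡ adj v u
    irref : ∀ v → adj v v ≡ false

open Graph public

Adj : ∀ {n} → Graph n → Fin n → Fin n → Set
Adj G u v = T (adj G u v)

deg : ∀ {n} → Graph n → Fin n → ℕ
deg {n} G v = sum (map (λ w → if adj G v w then 1 else 0) (allFin n))

data Chain {n : ℕ} (G : Graph n) : List (Fin n) → Set where
  chain-[]  : Chain G []
  chain-[_] : ∀ v → Chain G (v ∷ [])
  chain-∷   : ∀ {u v vs} → Adj G u v → Chain G (v ∷ vs) → Chain G (u ∷ v ∷ vs)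

Walk : ∀ {n} → Graph n → Fin n → Fin n → List (Fin n) → Set
Walk G u v ws = Chain G ws × head ws ≡ just u × last ws ≡ just v

Connected : ∀ {n} → Graph n → Set
Connected {n} G = ∀ (u v : Fin n) → ∃[ ws ] Walk G u v ws

IsPath : ∀ {n} → Graph n → List (Fin n) → Set
IsPath G ps = Chain G ps × Unique ps

Traceable : ∀ {n} → Graph n → Set
Traceable {n} G = ∃[ ps ] (IsPath G ps × (∀ (v : Fin n) → v ∈ ps))

InducedP3 : ∀ {n} → Graph n → Fin n → Fin n → Fin n → Set
InducedP3 G x y z =
  x ≢ y × y ≢ z × x ≢ z × Adj G x y × Adj G y z × ¬ Adj G x z

data In3 {n : ℕ} (x y z : Fin n) : Fin n → Set where
  in-x : In3 x y z x
  in-y : In3 x y z y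
  in-z : In3 x y z z

P3-o₋₁-Heavy : ∀ {n} → Graph n → Set
P3-o₋₁-Heavy {n} G =
  ∀ (x y z : Fin n) → InducedP3 G x y z →
    ∃[ a ] ∃[ b ] (In3 x y z a × In3 x y z b × a ≢ b × ¬ Adj G a b
                   × deg G a + deg G b ≥ n ∸ 1)

-- Let P be a longest path and suppose it misses a vertex.  By connectivity some w ∉ P is
-- adjacent to a vertex a of P.  If a is the last vertex, or w is adjacent to the successor x
-- of a, then w extends P.  Otherwise w a x is an induced P₃, so d(w) + d(x) ≥ n - 1 by
-- heaviness.  Each of the following would give a longer path (insert w, together with the
-- common neighbour, or after reversing a segment of P): w ~ last P, x ~ first P, a common
-- neighbour of w and x outside P, consecutive vertices p, q of P with w ~ p and x ~ q.
-- Hence P sends at most one edge to {w, x} per consecutive pair, i.e. at most |P| - 1, and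
-- the vertices outside P at most n - |P| - 1, so d(w) + d(x) ≤ n - 2.

module Submission where

open import Algebra.Properties.CommutativeSemigroup using (interchange; xy∙z≈y∙xz)
open import Data.Bool using (true; false; if_then_else_; T)
open import Data.Empty using (⊥-elim)
open import Data.Fin using (Fin; _≟_)
open import Data.Fin.Properties using (any?; all?; ¬∀⟶∃¬)
open import Data.List
  using (List; []; _∷_; _++_; [_]; map; head; last; reverse; length; filter; allFin)
open import Data.List.Properties
  using (++-assoc; unfold-reverse; reverse-involutive; map-++; length-++; length-tabulate)
open import Data.List.Membership.Propositional using (_∈_; _∉_)
import Data.List.Membership.DecPropositional as DecMembership
open import Data.List.Membership.Propositional.Properties
  using (∈-allFin; ∈-filter⁺; ∈-filter⁻; ∈-++⁺ˡ; ∈-++⁺ʳ; ∈-∃++)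
open import Data.List.Membership.Propositional.Properties.WithK using (unique∧set⇒bag)
open import Data.List.Relation.Binary.BagAndSetEquality using (∼bag⇒↭)
open import Data.List.Relation.Binary.Disjoint.Propositional using (Disjoint)
open import Data.List.Relation.Binary.Permutation.Propositional using (_↭_; prep; ↭-sym; ↭-trans; ↭⇒↭ₛ)
open import Data.List.Relation.Binary.Permutation.Propositional.Properties as ↭
  using (↭-length; shift; ++⁺ˡ; ++⁺ʳ; ↭-reverse; ++-comm)
open import Data.List.Relation.Binary.Permutation.Setoid.Properties using (Unique-resp-↭)
open import Data.List.Relation.Unary.All.Properties using (¬Any⇒All¬)
open import Data.List.Relation.Unary.AllPairs using ([]; _∷_)
open import Data.List.Relation.Unary.Any using (here; there)
open import Data.List.Relation.Unary.Linked as Linked using (Linked; []; [-]; _∷_)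
open import Data.List.Relation.Unary.Linked.Properties using (++⁺)
open import Data.List.Relation.Unary.Unique.Propositional using (Unique)
import Data.List.Relation.Unary.Unique.Propositional.Properties as Unique
open import Data.Maybe using (Maybe; just; nothing; maybe)
open import Data.Maybe.Relation.Unary.Any using (Any; just)
open import Data.Maybe.Relation.Binary.Connected using (just; nothing-just; connected?)
  renaming (Connected to MaybeConnected; sym to MaybeConnected-sym)
open import Data.Nat using (ℕ; zero; suc; _+_; _∸_; _≤_; _<_; z≤n; s≤s)
open import Data.Nat.ListAction using (sum)
open import Data.Nat.ListAction.Properties using (sum-++; sum-↭)
open import Data.Nat.Properties
  using ( +-comm; +-assoc; +-identityʳ; +-suc; +-monoʳ-≤; +-monoˡ-≤; +-mono-≤; +-mono-≤-<
        ; ≤-refl; ≤-reflexive; ≤-trans; n<1+n; m≤n⇒m≤1+n; m≤m+n; <⇒≱; 1+n≰n; ∸-monoˡ-≤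
        ; +-commutativeSemigroup; module ≤-Reasoning )
open import Data.Product using (∃-syntax; _×_; _,_; proj₁; proj₂)
open import Data.Sum using (_⊎_; inj₁; inj₂)
open import Function.Base using (_∘_)
open import Function.Bundles using (mk⇔)
open import Relation.Binary.Definitions using (Decidable; Symmetric)
open import Relation.Binary.PropositionalEquality
  using (_≡_; _≢_; refl; sym; trans; cong; cong₂; subst; setoid; module ≡-Reasoning)
open import Relation.Nullary using (¬_; Dec; yes; no)
open import Relation.Nullary.Decidable using (T?; ¬?; _×-dec_)
open import Defs hiding (sym)

module _ {A : Set} where

  last-++ : ∀ xs (y : A) ys → last (xs ++ y ∷ ys) ≡ last (y ∷ ys)
  last-++ []           y ys = refl
  last-++ (x ∷ [])     y ys = refl
  last-++ (x ∷ x′ ∷ xs) y ys = last-++ (x′ ∷ xs) y ys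

  last-reverse : ∀ (xs : List A) → last (reverse xs) ≡ head xs
  last-reverse []       = refl
  last-reverse (x ∷ xs) rewrite unfold-reverse x xs = last-++ (reverse xs) x []

  head-reverse : ∀ (xs : List A) → head (reverse xs) ≡ last xs
  head-reverse xs = subst (λ ys → head (reverse xs) ≡ last ys) (reverse-involutive xs)
                      (sym (last-reverse (reverse xs)))

  ∉⇒Unique-∷ : ∀ {v : A} {vs} → v ∉ vs → Unique vs → Unique (v ∷ vs)
  ∉⇒Unique-∷ {vs = vs} v∉vs vs! = ¬Any⇒All¬ vs v∉vs ∷ vs!

  HasConsecutive : (A → A → Set) → List A → Set
  HasConsecutive R xs = ∃[ ys ] ∃[ p ] ∃[ q ] ∃[ zs ] (xs ≡ ys ++ p ∷ q ∷ zs × R p q)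

  module _ {R : A → A → Set} where

    Linked-++⁻ : ∀ xs {ys} → Linked R (xs ++ ys) → Linked R xs × Linked R ys
    Linked-++⁻ []            l       = [] , l
    Linked-++⁻ (x ∷ [])      [-]     = [-] , []
    Linked-++⁻ (x ∷ [])      (_ ∷ l) = [-] , l
    Linked-++⁻ (x ∷ x′ ∷ xs) (r ∷ l) with Linked-++⁻ (x′ ∷ xs) l
    ... | lxs , lys = r ∷ lxs , lys

    Linked-reverse : Symmetric R → ∀ {xs} → Linked R xs → Linked R (reverse xs)
    Linked-reverse R-sym []                = []
    Linked-reverse R-sym [-]               = [-]
    Linked-reverse R-sym {x ∷ y ∷ xs} (r ∷ l) rewrite unfold-reverse x (y ∷ xs) =
      ++⁺ (Linked-reverse R-sym l) junction [-]
      where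
      junction : MaybeConnected R (last (reverse (y ∷ xs))) (just x)
      junction rewrite last-reverse (y ∷ xs) = just (R-sym r)

    linked⊎hasConsecutive : Decidable R → ∀ xs → Linked (λ p q → ¬ R p q) xs ⊎ HasConsecutive R xs
    linked⊎hasConsecutive R? []           = inj₁ []
    linked⊎hasConsecutive R? (x ∷ [])     = inj₁ [-]
    linked⊎hasConsecutive R? (x ∷ y ∷ xs) with R? x y | linked⊎hasConsecutive R? (y ∷ xs)
    ... | yes r | _  = inj₂ ([] , x , y , xs , refl , r)
    ... | no ¬r | inj₁ l = inj₁ (¬r ∷ l)
    ... | no ¬r | inj₂ (ys , p , q , zs , eq , r) = inj₂ (x ∷ ys , p , q , zs , cong (x ∷_) eq , r)

  sum-map-+ : ∀ (f g : A → ℕ) xs → sum (map (λ u → f u + g u) xs) ≡ sum (map f xs) + sum (map g xs)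
  sum-map-+ f g []       = refl
  sum-map-+ f g (x ∷ xs) rewrite sum-map-+ f g xs =
    interchange +-commutativeSemigroup (f x) (g x) (sum (map f xs)) (sum (map g xs))

  -- Each consecutive pair p, q contributes f p + g q ≤ 1; only g of the first and f of the
  -- last entry are left unpaired.
  sum-linked-≤ : ∀ {f g : A → ℕ} xs → Linked (λ p q → f p + g q ≤ 1) xs →
    sum (map (λ u → f u + g u) xs) ≤ maybe g 0 (head xs) + (length xs ∸ 1 + maybe f 0 (last xs))
  sum-linked-≤ []  []  = z≤n
  sum-linked-≤ {f} {g} (x ∷ []) [-] = ≤-reflexive (trans (+-identityʳ _) (+-comm (f x) (g x)))
  sum-linked-≤ {f} {g} (x ∷ y ∷ xs) (fx+gy≤1 ∷ l) = begin
    (f x + g x) + sum (map (λ u → f u + g u) (y ∷ xs))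
      ≤⟨ +-monoʳ-≤ (f x + g x) (sum-linked-≤ {f} {g} (y ∷ xs) l) ⟩
    (f x + g x) + (g y + R)       ≡⟨ xy∙z≈y∙xz +-commutativeSemigroup (f x) (g x) (g y + R) ⟩
    g x + (f x + (g y + R))       ≡⟨ cong (g x +_) (sym (+-assoc (f x) (g y) R)) ⟩
    g x + ((f x + g y) + R)       ≤⟨ +-monoʳ-≤ (g x) (+-monoˡ-≤ R fx+gy≤1) ⟩
    g x + (1 + R)                 ∎
    where
    open ≤-Reasoning
    R = length xs + maybe f 0 (last (y ∷ xs))

  sum-<-length : ∀ {f : A → ℕ} {v} xs → (∀ {u} → u ∈ xs → f u ≤ 1) → v ∈ xs → f v ≡ 0 →
    sum (map f xs) < length xs
  sum-<-length {f} (x ∷ xs) f≤1 (here refl) fv≡0 rewrite fv≡0 =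
    s≤s (sum-≤-length xs (f≤1 ∘ there))
    where
    sum-≤-length : ∀ ys → (∀ {u} → u ∈ ys → f u ≤ 1) → sum (map f ys) ≤ length ys
    sum-≤-length []       _   = z≤n
    sum-≤-length (y ∷ ys) f≤1 = +-mono-≤ (f≤1 (here refl)) (sum-≤-length ys (f≤1 ∘ there))
  sum-<-length {f} (x ∷ xs) f≤1 (there v∈xs) fv≡0 =
    +-mono-≤-< (f≤1 (here refl)) (sum-<-length xs (f≤1 ∘ there) v∈xs fv≡0)

module _ {n : ℕ} where
  open DecMembership (_≟_ {n}) using (_∈?_; _∉?_)

  outside : List (Fin n) → List (Fin n)
  outside ps = filter (_∉? ps) (allFin n)

  ++-outside-↭ : ∀ {ps} → Unique ps → ps ++ outside ps ↭ allFin n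
  ++-outside-↭ {ps} ps! = ∼bag⇒↭ (unique∧set⇒bag
    (Unique.++⁺ ps! (Unique.filter⁺ (_∉? ps) (Unique.allFin⁺ n)) disjoint)
    (Unique.allFin⁺ n)
    (mk⇔ (λ _ → ∈-allFin _) complete))
    where
    disjoint : Disjoint ps (outside ps)
    disjoint (v∈ps , v∈out) = proj₂ (∈-filter⁻ (_∉? ps) {xs = allFin n} v∈out) v∈ps
    complete : ∀ {v} → v ∈ allFin n → v ∈ ps ++ outside ps
    complete {v} v∈all with v ∈? ps
    ... | yes v∈ps = ∈-++⁺ˡ v∈ps
    ... | no  v∉ps = ∈-++⁺ʳ ps (∈-filter⁺ (_∉? ps) v∈all v∉ps)

  sum-allFin : ∀ {ps} → Unique ps → ∀ h →
    sum (map h (allFin n)) ≡ sum (map h ps) + sum (map h (outside ps))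
  sum-allFin {ps} ps! h = begin
    sum (map h (allFin n))               ≡⟨ sum-↭ (↭.map⁺ h (↭-sym (++-outside-↭ ps!))) ⟩
    sum (map h (ps ++ outside ps))       ≡⟨ cong sum (map-++ h ps (outside ps)) ⟩
    sum (map h ps ++ map h (outside ps)) ≡⟨ sum-++ (map h ps) (map h (outside ps)) ⟩
    sum (map h ps) + sum (map h (outside ps)) ∎
    where open ≡-Reasoning

  length-+-outside : ∀ {ps} → Unique ps → length ps + length (outside ps) ≡ n
  length-+-outside {ps} ps! =
    trans (sym (length-++ ps)) (trans (↭-length (++-outside-↭ ps!)) (length-tabulate (λ i → i)))

  length≤n : ∀ {ps} → Unique ps → length ps ≤ n
  length≤n {ps} ps! = subst (length ps ≤_) (length-+-outside ps!) (m≤m+n (length ps) _)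

module _ {n : ℕ} (G : Graph n) where
  open DecMembership (_≟_ {n}) using (_∈?_)

  adj? : ∀ u v → Dec (Adj G u v)
  adj? u v = T? (adj G u v)

  adj-sym : ∀ {u v} → Adj G u v → Adj G v u
  adj-sym {u} {v} u~v = subst T (Graph.sym G u v) u~v

  adj-irrefl : ∀ {v} → ¬ Adj G v v
  adj-irrefl {v} v~v = subst T (irref G v) v~v

  -- deg G v is definitionally sum (map (adjℕ v) (allFin n)).
  adjℕ : Fin n → Fin n → ℕ
  adjℕ v u = if adj G v u then 1 else 0

  adjℕ-≡0 : ∀ {v u} → ¬ Adj G v u → adjℕ v u ≡ 0
  adjℕ-≡0 {v} {u} v≁u with adj G v u
  ... | true  = ⊥-elim (v≁u _)
  ... | false = refl

  adjℕ-≤1 : ∀ v u → adjℕ v u ≤ 1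
  adjℕ-≤1 v u with adj G v u
  ... | true  = ≤-refl
  ... | false = z≤n

  adjℕ-+-≤1 : ∀ {v p u q} → ¬ (Adj G v p × Adj G u q) → adjℕ v p + adjℕ u q ≤ 1
  adjℕ-+-≤1 {v} {p} {u} {q} ¬both with adj G v p | adj G u q
  ... | true  | true  = ⊥-elim (¬both (_ , _))
  ... | true  | false = ≤-refl
  ... | false | true  = ≤-refl
  ... | false | false = z≤n

  chain⇒linked : ∀ {xs} → Chain G xs → Linked (Adj G) xs
  chain⇒linked chain-[]         = []
  chain⇒linked chain-[ _ ]      = [-]
  chain⇒linked (chain-∷ u~v c)  = u~v ∷ chain⇒linked c

  linked⇒chain : ∀ {xs} → Linked (Adj G) xs → Chain G xs
  linked⇒chain []          = chain-[]
  linked⇒chain [-]         = chain-[ _ ]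
  linked⇒chain (u~v ∷ l)   = chain-∷ u~v (linked⇒chain l)

  infix 4 _~ₘ_
  _~ₘ_ : Maybe (Fin n) → Maybe (Fin n) → Set
  _~ₘ_ = MaybeConnected (Adj G)

  ~ₘ-sym : ∀ {m m′} → m ~ₘ m′ → m′ ~ₘ m
  ~ₘ-sym = MaybeConnected-sym adj-sym

  any⇒connected : ∀ {m w} → Any (λ a → Adj G a w) m → m ~ₘ just w
  any⇒connected (just a~w) = just a~w

  last-∷ʳ-~ₘ : ∀ L {a w} → Adj G a w → last (L ++ [ a ]) ~ₘ just w
  last-∷ʳ-~ₘ L {a} {w} a~w = subst (_~ₘ just w) (sym (last-++ L a [])) (just a~w)

  NotLongest : List (Fin n) → Set
  NotLongest ps = ∃[ qs ] (IsPath G qs × length ps < length qs)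

  notLongest-↭ : ∀ ps {qs rs} → Linked (Adj G) qs → Unique rs → qs ↭ rs →
    length ps < length rs → NotLongest ps
  notLongest-↭ ps qs-linked rs! qs↭rs ps<rs =
    _ , (linked⇒chain qs-linked , Unique-resp-↭ (setoid (Fin n)) (↭⇒↭ₛ (↭-sym qs↭rs)) rs!) ,
    subst (length ps <_) (sym (↭-length qs↭rs)) ps<rs

  notLongest-∷ʳ : ∀ {ps w} → IsPath G ps → w ∉ ps →
    last ps ~ₘ just w → NotLongest ps
  notLongest-∷ʳ {ps} {w} (c , ps!) w∉ps last~w =
    notLongest-↭ ps (++⁺ (chain⇒linked c) last~w [-]) (∉⇒Unique-∷ w∉ps ps!) (++-comm ps [ w ]) (n<1+n _)

  notLongest-insert-reversed : ∀ P₁ s S P₂ {ps w} → ps ≡ P₁ ++ (s ∷ S) ++ P₂ →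
    IsPath G ps → w ∉ ps →
    last P₁ ~ₘ just w → just w ~ₘ last (s ∷ S) → just s ~ₘ head P₂ →
    NotLongest ps
  notLongest-insert-reversed P₁ s S P₂ {w = w} refl (c , ps!) w∉ps P₁~w w~S S~P₂ =
    notLongest-↭ (P₁ ++ (s ∷ S) ++ P₂) new-linked (∉⇒Unique-∷ w∉ps ps!) new↭ (n<1+n _)
    where
    pieces = Linked-++⁻ P₁ (chain⇒linked c)
    S-pieces = Linked-++⁻ (s ∷ S) (proj₂ pieces)
    w-S : Linked (Adj G) (w ∷ reverse (s ∷ S))
    w-S = ++⁺ [-] (subst (just w ~ₘ_) (sym (head-reverse (s ∷ S))) w~S)
                  (Linked-reverse adj-sym (proj₁ S-pieces))
    last-w-S : last (w ∷ reverse (s ∷ S)) ≡ just s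
    last-w-S rewrite unfold-reverse s S = last-++ (w ∷ reverse S) s []
    new-linked : Linked (Adj G) (P₁ ++ w ∷ reverse (s ∷ S) ++ P₂)
    new-linked = ++⁺ (proj₁ pieces) P₁~w
      (++⁺ w-S (subst (_~ₘ head P₂) (sym last-w-S) S~P₂) (proj₂ S-pieces))
    new↭ : P₁ ++ w ∷ reverse (s ∷ S) ++ P₂ ↭ w ∷ P₁ ++ (s ∷ S) ++ P₂
    new↭ = ↭-trans (shift w P₁ (reverse (s ∷ S) ++ P₂))
                   (prep w (++⁺ˡ P₁ (++⁺ʳ P₂ (↭-reverse (s ∷ S)))))

  notLongest-insert₂ : ∀ P₁ P₂ {w v} → IsPath G (P₁ ++ P₂) → w ∉ P₁ ++ P₂ → v ∉ P₁ ++ P₂ → w ≢ v →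
    last P₁ ~ₘ just w → Adj G w v → just v ~ₘ head P₂ →
    NotLongest (P₁ ++ P₂)
  notLongest-insert₂ P₁ P₂ {w} {v} (c , ps!) w∉ps v∉ps w≢v P₁~w w~v v~P₂ =
    notLongest-↭ (P₁ ++ P₂) new-linked (∉⇒Unique-∷ w∉v∷ps (∉⇒Unique-∷ v∉ps ps!)) new↭
      (m≤n⇒m≤1+n (n<1+n _))
    where
    pieces = Linked-++⁻ P₁ (chain⇒linked c)
    new-linked : Linked (Adj G) (P₁ ++ w ∷ v ∷ P₂)
    new-linked = ++⁺ (proj₁ pieces) P₁~w (++⁺ (w~v ∷ [-]) v~P₂ (proj₂ pieces))
    w∉v∷ps : w ∉ v ∷ P₁ ++ P₂
    w∉v∷ps (here w≡v)   = w≢v w≡v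
    w∉v∷ps (there w∈ps) = w∉ps w∈ps
    new↭ : P₁ ++ w ∷ v ∷ P₂ ↭ w ∷ v ∷ P₁ ++ P₂
    new↭ = ↭-trans (shift w P₁ (v ∷ P₂)) (prep w (shift v P₁ P₂))

  Crossing : Fin n → Fin n → Fin n → Fin n → Set
  Crossing w x p q = Adj G w p × Adj G x q

  crossing? : ∀ w x p q → Dec (Crossing w x p q)
  crossing? w x p q = adj? w p ×-dec adj? x q

  crossing⇒notLongest : ∀ P x R {w} → IsPath G (P ++ x ∷ R) → w ∉ P ++ x ∷ R →
    Any (λ a → Adj G a w) (last P) → ¬ Adj G w x →
    HasConsecutive (Crossing w x) P ⊎ HasConsecutive (Crossing w x) (x ∷ R) →
    NotLongest (P ++ x ∷ R)
  crossing⇒notLongest P x R {w} path w∉ps P~w w≁x (inj₁ (A , p , q , B , refl , w~p , x~q)) =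
    notLongest-insert-reversed (A ++ [ p ]) q B (x ∷ R) ps≡ path w∉ps
      (last-∷ʳ-~ₘ A (adj-sym w~p))
      (subst (just w ~ₘ_) (last-++ A p (q ∷ B)) (~ₘ-sym (any⇒connected P~w)))
      (just (adj-sym x~q))
    where
    ps≡ : (A ++ p ∷ q ∷ B) ++ x ∷ R ≡ (A ++ [ p ]) ++ (q ∷ B) ++ x ∷ R
    ps≡ = trans (++-assoc A (p ∷ q ∷ B) (x ∷ R)) (sym (++-assoc A [ p ] (q ∷ B ++ x ∷ R)))
  crossing⇒notLongest P x R path w∉ps P~w w≁x (inj₂ ([] , .x , q , B , refl , w~x , x~q)) =
    ⊥-elim (w≁x w~x)
  crossing⇒notLongest P x R path w∉ps P~w w≁x (inj₂ (.x ∷ A , p , q , B , refl , w~p , x~q)) =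
    notLongest-insert-reversed P x (A ++ [ p ]) (q ∷ B)
      (cong (λ xs → P ++ x ∷ xs) (sym (++-assoc A [ p ] (q ∷ B)))) path w∉ps (any⇒connected P~w)
      (~ₘ-sym (last-∷ʳ-~ₘ (x ∷ A) (adj-sym w~p)))
      (just x~q)

  weight : Fin n → Fin n → Fin n → ℕ
  weight w x u = adjℕ w u + adjℕ x u

  maybe-adjℕ-≤1 : ∀ w m → maybe (adjℕ w) 0 m ≤ 1
  maybe-adjℕ-≤1 w (just u) = adjℕ-≤1 w u
  maybe-adjℕ-≤1 w nothing  = z≤n

  maybe-adjℕ-≡0 : ∀ {w} m → ¬ m ~ₘ just w → maybe (adjℕ w) 0 m ≡ 0
  maybe-adjℕ-≡0 (just u) u≁w = adjℕ-≡0 (λ w~u → u≁w (just (adj-sym w~u)))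
  maybe-adjℕ-≡0 nothing  _   = refl

  path-weight-bound : ∀ P x R {w} →
    Linked (λ p q → ¬ Crossing w x p q) P → Linked (λ p q → ¬ Crossing w x p q) (x ∷ R) →
    ¬ head P ~ₘ just x → ¬ last (x ∷ R) ~ₘ just w →
    sum (map (weight w x) (P ++ x ∷ R)) < length (P ++ x ∷ R)
  path-weight-bound P x R {w} P-linked Q-linked P≁x last≁w = begin-strict
    sum (map (weight w x) (P ++ x ∷ R))
      ≡⟨ cong sum (map-++ (weight w x) P (x ∷ R)) ⟩
    sum (map (weight w x) P ++ map (weight w x) (x ∷ R))
      ≡⟨ sum-++ (map (weight w x) P) _ ⟩
    sum (map (weight w x) P) + sum (map (weight w x) (x ∷ R))
      <⟨ +-mono-≤-< P-bound (s≤s Q-bound) ⟩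
    length P + length (x ∷ R)
      ≡⟨ sym (length-++ P) ⟩
    length (P ++ x ∷ R) ∎
    where
    open ≤-Reasoning
    pred-+-≤ : ∀ xs → length xs ∸ 1 + maybe (adjℕ w) 0 (last xs) ≤ length xs
    pred-+-≤ []       = z≤n
    pred-+-≤ (y ∷ ys) = begin
      length ys + maybe (adjℕ w) 0 (last (y ∷ ys))
        ≤⟨ +-monoʳ-≤ (length ys) (maybe-adjℕ-≤1 w (last (y ∷ ys))) ⟩
      length ys + 1
        ≡⟨ +-comm (length ys) 1 ⟩
      suc (length ys) ∎
    P-bound : sum (map (weight w x) P) ≤ length P
    P-bound = begin
      sum (map (weight w x) P)
        ≤⟨ sum-linked-≤ {f = adjℕ w} {g = adjℕ x} P (Linked.map adjℕ-+-≤1 P-linked) ⟩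
      maybe (adjℕ x) 0 (head P) + (length P ∸ 1 + maybe (adjℕ w) 0 (last P))
        ≡⟨ cong (_+ _) (maybe-adjℕ-≡0 (head P) P≁x) ⟩
      length P ∸ 1 + maybe (adjℕ w) 0 (last P)
        ≤⟨ pred-+-≤ P ⟩
      length P ∎
    Q-bound : sum (map (weight w x) (x ∷ R)) ≤ length R
    Q-bound = begin
      sum (map (weight w x) (x ∷ R))
        ≤⟨ sum-linked-≤ {f = adjℕ w} {g = adjℕ x} (x ∷ R) (Linked.map adjℕ-+-≤1 Q-linked) ⟩
      adjℕ x x + (length R + maybe (adjℕ w) 0 (last (x ∷ R)))
        ≡⟨ cong₂ (λ a b → a + (length R + b))
                 (adjℕ-≡0 adj-irrefl) (maybe-adjℕ-≡0 (last (x ∷ R)) last≁w) ⟩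
      length R + 0
        ≡⟨ +-identityʳ (length R) ⟩
      length R ∎

  degree-sum-bound : ∀ {ps w x} → Unique ps → w ∉ ps → ¬ Adj G w x →
    sum (map (weight w x) ps) < length ps →
    (∀ {v} → v ∉ ps → v ≢ w → ¬ (Adj G w v × Adj G x v)) →
    2 + (deg G w + deg G x) ≤ n
  degree-sum-bound {ps} {w} {x} ps! w∉ps w≁x path-bound no-common = begin
    2 + (deg G w + deg G x)
      ≡⟨ cong (2 +_) (trans (sym (sum-map-+ (adjℕ w) (adjℕ x) (allFin n)))
                            (sum-allFin ps! (weight w x))) ⟩
    2 + (Σp + Σo)             ≡⟨ cong suc (sym (+-suc Σp Σo)) ⟩
    suc Σp + suc Σo           ≤⟨ +-mono-≤ path-bound outside-bound ⟩
    length ps + length (outside ps) ≡⟨ length-+-outside ps! ⟩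
    n                         ∎
    where
    open ≤-Reasoning
    Σp = sum (map (weight w x) ps)
    Σo = sum (map (weight w x) (outside ps))
    weight-w : weight w x w ≡ 0
    weight-w = cong₂ _+_ (adjℕ-≡0 adj-irrefl) (adjℕ-≡0 (w≁x ∘ adj-sym))
    weight-≤1 : ∀ {v} → v ∈ outside ps → weight w x v ≤ 1
    weight-≤1 {v} v∈out with v ≟ w
    ... | yes refl = subst (_≤ 1) (sym weight-w) z≤n
    ... | no  v≢w  = adjℕ-+-≤1 (no-common (proj₂ (∈-filter⁻ _ {xs = allFin n} v∈out)) v≢w)
    outside-bound : Σo < length (outside ps)
    outside-bound = sum-<-length (outside ps) weight-≤1 (∈-filter⁺ _ (∈-allFin w) w∉ps) weight-w

  degree-sum⇒notLongest : ∀ P x R {ps w} → ps ≡ P ++ x ∷ R → IsPath G ps → w ∉ ps →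
    Any (λ a → Adj G a w) (last P) → ¬ Adj G w x →
    n ∸ 1 ≤ deg G w + deg G x → NotLongest ps
  degree-sum⇒notLongest P x R {w = w} refl path w∉ps P~w w≁x heavy
    with connected? adj? (head P) (just x)
  degree-sum⇒notLongest [] x R refl path w∉ps () w≁x heavy | _
  degree-sum⇒notLongest (z ∷ zs) x R refl path w∉ps P~w w≁x heavy | yes z~x =
    notLongest-insert-reversed [] z zs (x ∷ R) refl path w∉ps nothing-just
      (~ₘ-sym (any⇒connected P~w)) z~x
  ... | no P≁x with connected? adj? (last (P ++ x ∷ R)) (just w)
  ...   | yes last~w = notLongest-∷ʳ path w∉ps last~w
  ...   | no last≁w with any? (λ v → ¬? (v ∈? P ++ x ∷ R) ×-dec ¬? (v ≟ w) ×-dec adj? w v ×-dec adj? x v)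
  ...     | yes (v , v∉ps , v≢w , w~v , x~v) =
              notLongest-insert₂ P (x ∷ R) path w∉ps v∉ps (v≢w ∘ sym) (any⇒connected P~w) w~v
                (just (adj-sym x~v))
  ...     | no no-common
              with linked⊎hasConsecutive (crossing? w x) P | linked⊎hasConsecutive (crossing? w x) (x ∷ R)
  ...       | inj₂ P-crossing | _ = crossing⇒notLongest P x R path w∉ps P~w w≁x (inj₁ P-crossing)
  ...       | inj₁ _ | inj₂ Q-crossing = crossing⇒notLongest P x R path w∉ps P~w w≁x (inj₂ Q-crossing)
  ...       | inj₁ P-linked | inj₁ Q-linked = ⊥-elim (1+n≰n (≤-trans (∸-monoˡ-≤ 1 bound) heavy))
    where
    bound : 2 + (deg G w + deg G x) ≤ n
    bound = degree-sum-bound (proj₂ path) w∉ps w≁x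
              (path-weight-bound P x R P-linked Q-linked P≁x
                 (last≁w ∘ subst (_~ₘ just w) (sym (last-++ P x R))))
              (λ v∉ps v≢w common → no-common (_ , v∉ps , v≢w , common))

  -- the endpoints are the only nonadjacent pair of an induced P₃
  heavy-endpoints : P3-o₋₁-Heavy G → ∀ {w a x} → InducedP3 G w a x → n ∸ 1 ≤ deg G w + deg G x
  heavy-endpoints heavy {w} {a} {x} p3@(_ , _ , _ , w~a , a~x , _)
    with heavy w a x p3
  ... | _ , _ , in-x , in-z , _ , _ , ≥n-1 = ≥n-1
  ... | _ , _ , in-z , in-x , _ , _ , ≥n-1 = subst (n ∸ 1 ≤_) (+-comm (deg G x) (deg G w)) ≥n-1
  ... | _ , _ , in-x , in-y , _ , ≁ , _ = ⊥-elim (≁ w~a)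
  ... | _ , _ , in-y , in-x , _ , ≁ , _ = ⊥-elim (≁ (adj-sym w~a))
  ... | _ , _ , in-y , in-z , _ , ≁ , _ = ⊥-elim (≁ a~x)
  ... | _ , _ , in-z , in-y , _ , ≁ , _ = ⊥-elim (≁ (adj-sym a~x))
  ... | _ , _ , in-x , in-x , ≢ , _ , _ = ⊥-elim (≢ refl)
  ... | _ , _ , in-y , in-y , ≢ , _ , _ = ⊥-elim (≢ refl)
  ... | _ , _ , in-z , in-z , ≢ , _ , _ = ⊥-elim (≢ refl)

  edge-leaving⇒notLongest : P3-o₋₁-Heavy G → ∀ {ps a w} → IsPath G ps → a ∈ ps → w ∉ ps →
    Adj G a w → NotLongest ps
  edge-leaving⇒notLongest heavy {a = a} {w} path a∈ps w∉ps a~w with ∈-∃++ a∈ps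
  ... | L , [] , refl =
    notLongest-∷ʳ path w∉ps (last-∷ʳ-~ₘ L a~w)
  ... | L , x ∷ R , refl with adj? w x
  ...   | yes w~x =
    notLongest-insert-reversed (L ++ [ a ]) x [] R (sym (++-assoc L [ a ] (x ∷ R))) path w∉ps
      (last-∷ʳ-~ₘ L a~w) (just w~x)
      (Linked.head′ (Linked.tail (proj₂ (Linked-++⁻ L (chain⇒linked (proj₁ path))))))
  ...   | no w≁x =
    degree-sum⇒notLongest (L ++ [ a ]) x R (sym (++-assoc L [ a ] (x ∷ R))) path w∉ps
      (subst (Any (λ b → Adj G b w)) (sym (last-++ L a [])) (just a~w)) w≁x
      (heavy-endpoints heavy (w≢a , a≢x , w≢x , adj-sym a~w , a~x , w≁x))
    where
    a~x : Adj G a x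
    a~x = Linked.head (proj₂ (Linked-++⁻ L (chain⇒linked (proj₁ path))))
    w≢a : w ≢ a
    w≢a refl = w∉ps a∈ps
    a≢x : a ≢ x
    a≢x refl = adj-irrefl a~x
    w≢x : w ≢ x
    w≢x refl = w∉ps (∈-++⁺ʳ L (there (here refl)))

  crossing-edge : ∀ ps {ws u v} → Chain G ws → head ws ≡ just u → last ws ≡ just v →
    u ∈ ps → v ∉ ps → ∃[ a ] ∃[ b ] (a ∈ ps × b ∉ ps × Adj G a b)
  crossing-edge ps chain-[]    ()   _    _    _
  crossing-edge ps chain-[ _ ] refl refl u∈ps v∉ps = ⊥-elim (v∉ps u∈ps)
  crossing-edge ps (chain-∷ {u} {u′} u~u′ c) refl last≡v u∈ps v∉ps with u′ ∈? ps
  ... | yes u′∈ps = crossing-edge ps c refl last≡v u′∈ps v∉ps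
  ... | no  u′∉ps = u , u′ , u∈ps , u′∉ps , u~u′

  missing-vertex⇒notLongest : Connected G → P3-o₋₁-Heavy G → ∀ {ps v} → IsPath G ps → v ∉ ps →
    NotLongest ps
  missing-vertex⇒notLongest connected heavy {[]} {v} path v∉ps =
    [ v ] , (chain-[ v ] , ∉⇒Unique-∷ (λ ()) []) , s≤s z≤n
  missing-vertex⇒notLongest connected heavy {u ∷ us} {v} path v∉ps
    with connected u v
  ... | ws , c , head≡u , last≡v with crossing-edge (u ∷ us) c head≡u last≡v (here refl) v∉ps
  ...   | a , b , a∈ps , b∉ps , a~b = edge-leaving⇒notLongest heavy path a∈ps b∉ps a~b

  traceable-by-extension : (∀ {ps v} → IsPath G ps → v ∉ ps → NotLongest ps) →
    ∀ k {ps} → IsPath G ps → n ≤ k + length ps → Traceable G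
  traceable-by-extension extend k {ps} path n≤k+ps with all? (_∈? ps)
  ... | yes all∈ps = ps , path , all∈ps
  ... | no ¬all∈ps with ¬∀⟶∃¬ n (_∈ ps) (_∈? ps) ¬all∈ps
  ...   | v , v∉ps with extend path v∉ps | k
  ...     | qs , qs-path , ps<qs | zero =
              ⊥-elim (<⇒≱ ps<qs (≤-trans (length≤n (proj₂ qs-path)) n≤k+ps))
  ...     | qs , qs-path , ps<qs | suc k′ =
              traceable-by-extension extend k′ qs-path
                (≤-trans n≤k+ps (subst (_≤ k′ + length qs) (+-suc k′ (length ps)) (+-monoʳ-≤ k′ ps<qs)))

theorem5 : ∀ {n : ℕ} (G : Graph n) → Connected G → P3-o₋₁-Heavy G → Traceable G
theorem5 {n} G connected heavy =
  traceable-by-extension G (missing-vertex⇒notLongest G connected heavy) n (chain-[] , [])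
    (≤-reflexive (sym (+-identityʳ n)))
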